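{- The rule set $\mathcal{R}_{\mathrm{grid}}$ over the signature $\{H,V\}$ ($H,V$ binary), consisting of (loop) $\top\to\exists x\,(H(x,x)\wedge V(x,x))$, (grow) $\top(x)\to\exists y\,\exists y'\,(H(x,y)\wedge V(x,y'))$, (grid) $H(x,y)\wedge V(x,x')\to\exists y'\,(H(x',y')\wedge V(y,y'))$, is not a finite-cliquewidth set ($\mathbf{fcs}$).
   Context: $\top$ is a unary predicate holding of every term. Instances: countable sets of atoms with constants or nulls as terms; databases: finite instances with only constants; homomorphisms are identity on constants and preserve atoms. A model of $(\mathcal{D},\mathcal{R})$ is an instance containing $\mathcal{D}$ satisfying every rule; a universal model is a model with a homomorphism into every model. Cliquewidth: for a finite color set $\mathbb{L}$ and finite constant set $\mathrm{Cnst}$, a well-decorated tree labels each node of the infinite binary tree $\{0,1\}^*$ by exactly one of $c_k$ ($c\in\mathrm{Cnst}\cup\{*\}$), $\mathrm{Add}_{R,\vec k}$, $\mathrm{Recolor}_{k\to k'}$, $\oplus$, $\mathrm{Void}$, with: each constant decorated at most once; $\mathrm{Add}$/$\mathrm{Recolor}$ nodes have non-$\mathrm{Void}$ left and $\mathrm{Void}$ right child; $\oplus$ nodes have two non-$\mathrm{Void}$ children; $\mathrm{Void}$ and $c_k$ nodes have $\mathrm{Void}$ children. Node $s$ represents the elements introduced in its subtree ($*_k$ introduces the node itself as a null, $c_k$ the constant $c$), colored by introduction color as modified by $\mathrm{Recolor}_{k\to k'}$ nodes on the path up to $s$; $\oplus$ is disjoint union; $\mathrm{Add}_{R,\vec k}$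 adds $R(\vec e)$ for all tuples $\vec e$ of its elements colored $\vec k$. $\mathrm{cw}(I)$ is the least $|\mathbb{L}|$ such that some coloring of $I$ is isomorphic to the colored instance represented by a well-decorated tree ($\infty$ if none). A rule set is $\mathbf{fcs}$ if for every database $\mathcal{D}$ some universal model of $(\mathcal{D},\mathcal{R})$ has finite cliquewidth. -}

module Defs where

open import Data.Nat using (ℕ)
open import Data.Bool using (Bool; true; false; if_then_else_)
open import Data.List using (List; []; _∷_; _++_; [_])
open import Data.List.Membership.Propositional using (_∈_)
open import Data.Fin using (Fin; _≟_)
open import Data.Product using (Σ; ∃; _×_; _,_; ∃-syntax; proj₁; proj₂)
open import Data.Sum using (_⊎_; inj₁; inj₂)
open import Data.Unit using (⊤)
open import Data.Empty using (⊥)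
open import Relation.Binary.PropositionalEquality using (_≡_)
open import Relation.Nullary using (¬_)
open import Relation.Nullary.Decidable using (⌊_⌋)

-- Nodes of the infinite binary tree {0,1}* : paths from the root
-- (false = 0 = left, true = 1 = right).
Node : Set
Node = List Bool

-- Nulls: a countable set (we use {0,1}* so that a null may be a tree node).
Null : Set
Null = Node

data Term : Set where
  const : ℕ → Term
  null  : Null → Term

-- Dom x means ⊤(x) is an
-- atom, i.e. x is a term of the instance; every term occurring in an
-- H- or V-atom is a term of the instance.  (Term is countable, so every
-- instance is countable.)
record Instance : Set₁ where
  field
    Dom   : Term → Set
    H     : Term → Term → Set
    V     : Term → Term → Set
    H-dom : ∀ {x y} → H x y → Dom x × Dom y
    V-dom : ∀ {x y} → V x y → Dom x × Dom y
open Instance public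

data DbAtom : Set where
  topA : ℕ → DbAtom
  HA   : ℕ → ℕ → DbAtom
  VA   : ℕ → ℕ → DbAtom

Database : Set
Database = List DbAtom

HoldsIn : Instance → DbAtom → Set
HoldsIn I (topA c) = Dom I (const c)
HoldsIn I (HA c d) = H I (const c) (const d)
HoldsIn I (VA c d) = V I (const c) (const d)

Contains : Instance → Database → Set
Contains I D = ∀ a → a ∈ D → HoldsIn I a

SatLoop : Instance → Set
SatLoop I = ∃[ x ] (H I x x × V I x x)

SatGrow : Instance → Set
SatGrow I = ∀ x → Dom I x → ∃[ y ] ∃[ y' ] (H I x y × V I x y')

SatGrid : Instance → Set
SatGrid I = ∀ x y x' → H I x y → V I x x' → ∃[ y' ] (H I x' y' × V I y y')

ModelGrid : Database → Instance → Set
ModelGrid D I = Contains I D × SatLoop I × SatGrow I × SatGrid I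

record Hom (I J : Instance) : Set where
  field
    map      : Term → Term
    const-id : ∀ c → map (const c) ≡ const c
    dom-pres : ∀ {x} → Dom I x → Dom J (map x)
    H-pres   : ∀ {x y} → H I x y → H J (map x) (map y)
    V-pres   : ∀ {x y} → V I x y → V J (map x) (map y)
open Hom public

Iso : Instance → Instance → Set
Iso I J = Σ (Hom I J) λ f → Σ (Hom J I) λ g →
            (∀ x → Dom I x → map g (map f x) ≡ x) ×
            (∀ y → Dom J y → map f (map g y) ≡ y)

UniversalModelGrid : Database → Instance → Set₁
UniversalModelGrid D U = ModelGrid D U × (∀ M → ModelGrid D M → Hom U M)

data Label (n : ℕ) : Set where
  cst     : ℕ → Fin n → Label n
  star    : Fin n → Label n
  addH    : Fin n → Fin n → Label n
  addV    : Fin n → Fin n → Label n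
  recolor : Fin n → Fin n → Label n
  oplus   : Label n
  void    : Label n

Tree : ℕ → Set
Tree n = Node → Label n

child : Node → Bool → Node
child s b = s ++ [ b ]

IsUnary : ∀ {n} → Label n → Set
IsUnary (addH _ _)    = ⊤
IsUnary (addV _ _)    = ⊤
IsUnary (recolor _ _) = ⊤
IsUnary _             = ⊥

IsLeaf : ∀ {n} → Label n → Set
IsLeaf (cst _ _) = ⊤
IsLeaf (star _)  = ⊤
IsLeaf void      = ⊤
IsLeaf _         = ⊥

record WellDecorated {n : ℕ} (Cnst : List ℕ) (T : Tree n) : Set where
  field
    cst-in   : ∀ t c k → T t ≡ cst c k → c ∈ Cnst
    cst-once : ∀ t t' c k k' → T t ≡ cst c k → T t' ≡ cst c k' → t ≡ t'
    unary    : ∀ t → IsUnary (T t) →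
                 ¬ (T (child t false) ≡ void) × T (child t true) ≡ void
    binary   : ∀ t → T t ≡ oplus →
                 ¬ (T (child t false) ≡ void) × ¬ (T (child t true) ≡ void)
    leaf     : ∀ t → IsLeaf (T t) →
                 T (child t false) ≡ void × T (child t true) ≡ void

act : ∀ {n} → Label n → Fin n → Fin n
act (recolor i j) k = if ⌊ k ≟ i ⌋ then j else k
act _             k = k

-- colour, as seen at node s, of an element introduced at node s ++ p with
-- colour k: apply the Recolor nodes strictly above s ++ p, up to and
-- including s, bottom-up.
colorUp : ∀ {n} → Tree n → Node → Node → Fin n → Fin n
colorUp T s []      k = k
colorUp T s (b ∷ p) k = act (T s) (colorUp T (child s b) p k)

Intro : ∀ {n} → Tree n → Node → Term → Fin n → Set
Intro T t x k = (∃[ c ] (T t ≡ cst c k × x ≡ const c))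
              ⊎ (T t ≡ star k × x ≡ null t)

ColoredAt : ∀ {n} → Tree n → Node → Term → Fin n → Set
ColoredAt T s x k = ∃[ p ] ∃[ k₀ ] (Intro T (s ++ p) x k₀ × colorUp T s p k₀ ≡ k)

private
  colored⇒dom : ∀ {n} {T : Tree n} {s x k} → ColoredAt T s x k →
                ∃[ t ] ∃[ k' ] Intro T t x k'
  colored⇒dom (p , k₀ , i , _) = (_ , k₀ , i)

Rep : ∀ {n} → Tree n → Instance
Rep T = record
  { Dom   = λ x → ∃[ t ] ∃[ k ] Intro T t x k
  ; H     = λ x y → ∃[ s ] ∃[ k₁ ] ∃[ k₂ ]
              (T s ≡ addH k₁ k₂ × ColoredAt T s x k₁ × ColoredAt T s y k₂)
  ; V     = λ x y → ∃[ s ] ∃[ k₁ ] ∃[ k₂ ]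
              (T s ≡ addV k₁ k₂ × ColoredAt T s x k₁ × ColoredAt T s y k₂)
  ; H-dom = λ { (s , k₁ , k₂ , _ , cx , cy) → colored⇒dom cx , colored⇒dom cy }
  ; V-dom = λ { (s , k₁ , k₂ , _ , cx , cy) → colored⇒dom cx , colored⇒dom cy }
  }

-- cw(I) < ∞ : some colouring of I is isomorphic to the coloured instance
-- represented by a well-decorated tree over finite colours Fin n and a finite
-- constant set Cnst (the colouring is then just the one transported along the
-- isomorphism, so only the uncoloured isomorphism needs to be required).
FiniteCW : Instance → Set
FiniteCW I = ∃[ n ] Σ (List ℕ) λ Cnst → Σ (Tree n) λ T →
               WellDecorated Cnst T × Iso I (Rep T)

FcsGrid : Set₁
FcsGrid = ∀ (D : Database) → Σ Instance λ U → UniversalModelGrid D U × FiniteCW U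

{-# OPTIONS --safe #-}
module Submission where

-- From the database constant, (grow) and (grid) build an ℕ × ℕ grid of H- and
-- V-edges in every model.  In a universal model U this grid maps into the model
-- of positions in the quarter plane (plus a loop point), so its points are
-- pairwise distinct, V-edges keep the first and H-edges the second coordinate.
-- Suppose a well-decorated tree with n colors represents U and take a deepest
-- node s below which a whole row or column of the (2n+2) × (2n+2) subgrid is
-- introduced, say a column.  s is not a leaf (it would introduce two points)
-- nor unary (its left child would contain the column too), so s is a ⊕-node.
-- Every row meets the column below s but no row lies below one child, so each
-- row has an edge leaving one of the two subtrees.  By pigeonhole two rows leave
-- the same subtree from endpoints of the same color there.  The Add-node of the
-- first edge lies above that subtree, so it also links the second row's endpoint
-- to the first row, and the two rows coincide.

open import Defs
open import Data.Bool using (Bool; true; false)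
import Data.Bool as Bool
open import Data.Empty using (⊥; ⊥-elim)
open import Data.Fin using (Fin; toℕ; combine) renaming (zero to fzero; suc to fsuc)
open import Data.Fin.Properties
  using (any?; all?; ¬∀⟶∃¬; pigeonhole; toℕ-injective; combine-injective; <⇒≢; 2↔Bool)
open import Data.List using ([]; _∷_; _++_; [_]; length)
open import Data.List.Properties using (++-assoc; ++-identityʳ; ++-cancelˡ; ∷-injective; length-++)
open import Data.List.Relation.Unary.Any using (here; there)
open import Data.Maybe using (Maybe; just; nothing)
open import Data.Nat using (ℕ; zero; suc; _+_; _*_; _≤_; _<_; _⊔_; s≤s)
open import Data.Nat.Properties
  using (≤-refl; ≤-trans; ≤-reflexive; m≤m+n; m≤m⊔n; m≤n⊔m; n≤1+n; +-suc; +-comm; +-identityʳ; <⇒≱; 0≢1+n)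
open import Data.Product using (Σ; ∃-syntax; _×_; _,_; proj₁; proj₂)
open import Data.Sum using (_⊎_; inj₁; inj₂)
import Data.Sum as Sum
open import Data.Unit using (⊤; tt)
open import Function using (_∘_; Inverse; Injection)
open import Function.Properties.Inverse using (↔-sym; ↔⇒↣)
open import Relation.Binary.PropositionalEquality using (_≡_; refl; sym; trans; cong; subst; module ≡-Reasoning)
open import Relation.Nullary using (¬_; Dec; yes; no)
open import Relation.Nullary.Decidable using (¬?; decidable-stable; _⊎-dec_)
open import Relation.Unary using (Decidable)

infix 4 _⊑_ _⊑?_

_⊑_ : Node → Node → Set
s ⊑ t = ∃[ q ] s ++ q ≡ t

∷-⊑ : ∀ {b s t} → s ⊑ t → b ∷ s ⊑ b ∷ t
∷-⊑ {b} (q , e) = q , cong (b ∷_) e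

_⊑?_ : (s t : Node) → Dec (s ⊑ t)
[] ⊑? t = yes (t , refl)
(b ∷ s) ⊑? [] = no λ ()
(b ∷ s) ⊑? (c ∷ t) with b Bool.≟ c | s ⊑? t
... | yes refl | yes s⊑t = yes (∷-⊑ s⊑t)
... | yes refl | no s⋢t = no λ (q , e) → s⋢t (q , proj₂ (∷-injective e))
... | no b≢c | _ = no λ (q , e) → b≢c (proj₁ (∷-injective e))

⊑-trans : ∀ {s t u} → s ⊑ t → t ⊑ u → s ⊑ u
⊑-trans {s} (p , refl) (q , refl) = p ++ q , sym (++-assoc s p q)

⊑-comparable : ∀ {s t u} → s ⊑ u → t ⊑ u → s ⊑ t ⊎ t ⊑ s
⊑-comparable {[]} _ _ = inj₁ (_ , refl)
⊑-comparable {_ ∷ _} {[]} _ _ = inj₂ (_ , refl)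
⊑-comparable {a ∷ s} {b ∷ t} (p , refl) (q , e) with ∷-injective e
... | refl , e′ = Sum.map ∷-⊑ ∷-⊑ (⊑-comparable (p , refl) (q , e′))

⊑-length : ∀ {s t} → s ⊑ t → length s ≤ length t
⊑-length {s} (q , refl) = ≤-trans (m≤m+n _ _) (≤-reflexive (sym (length-++ s)))

length-child : ∀ s b → length (child s b) ≡ suc (length s)
length-child s b = trans (length-++ s) (+-comm (length s) 1)

⊑-children : ∀ {s t} → s ⊑ t → t ≡ s ⊎ Σ Bool λ b → child s b ⊑ t
⊑-children {s} ([] , e) = inj₁ (trans (sym e) (++-identityʳ s))
⊑-children {s} (b ∷ q , e) = inj₂ (b , q , trans (++-assoc s [ b ] q) e)

deepest : (F : Node → Set) → Decidable F → ∀ B → (∀ {s} → F s → length s ≤ B) → F [] →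
          ∃[ s ] (F s × ∀ b → ¬ F (child s b))
deepest F F? B bound F[] = descend (suc B) [] F[] ≤-refl
  where
    deeper : ∀ {s k} b → B < length s + suc k → B < length (child s b) + k
    deeper {s} {k} b = subst (B <_) (trans (+-suc (length s) k) (cong (_+ k) (sym (length-child s b))))

    descend : ∀ k s → F s → B < length s + k → ∃[ s ] (F s × ∀ b → ¬ F (child s b))
    descend zero s Fs B<s = ⊥-elim (<⇒≱ (subst (B <_) (+-identityʳ _) B<s) (bound Fs))
    descend (suc k) s Fs B<s with F? (child s false) | F? (child s true)
    ... | yes F₀ | _ = descend k (child s false) F₀ (deeper {s} false B<s)
    ... | no _ | yes F₁ = descend k (child s true) F₁ (deeper {s} true B<s)
    ... | no ¬F₀ | no ¬F₁ = s , Fs , λ { false → ¬F₀ ; true → ¬F₁ }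

bounded : ∀ {m} (f : Fin m → ℕ) → ∃[ B ] ∀ i → f i ≤ B
bounded {zero} f = 0 , λ ()
bounded {suc m} f with bounded (f ∘ fsuc)
... | B , f≤B = f fzero ⊔ B , λ { fzero → m≤m⊔n _ _ ; (fsuc i) → ≤-trans (f≤B i) (m≤n⊔m _ _) }

boundary-from-zero : ∀ {Q : ℕ → Set} → Decidable Q → Q 0 → ∀ b → ¬ Q b → ∃[ k ] (Q k × ¬ Q (suc k))
boundary-from-zero Q? q₀ zero ¬q = ⊥-elim (¬q q₀)
boundary-from-zero Q? q₀ (suc b) ¬q with Q? b
... | yes q = b , q , ¬q
... | no ¬q′ = boundary-from-zero Q? q₀ b ¬q′

boundary : ∀ {P : ℕ → Set} → Decidable P → ∀ {a b} → P a → ¬ P b →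
           ∃[ k ] ((P k × ¬ P (suc k)) ⊎ (¬ P k × P (suc k)))
boundary {P} P? {a} {b} pa ¬pb with P? 0
... | yes p₀ = let k , pk , ¬pk′ = boundary-from-zero P? p₀ b ¬pb in k , inj₁ (pk , ¬pk′)
... | no ¬p₀ =
  let k , ¬pk , ¬¬pk′ = boundary-from-zero {λ k → ¬ P k} (¬? ∘ P?) ¬p₀ a (λ ¬pa → ¬pa pa)
  in k , inj₂ (¬pk , decidable-stable (P? (suc k)) ¬¬pk′)

bit : Bool → Fin 2
bit = Inverse.from 2↔Bool

bit-injective : ∀ {a b} → bit a ≡ bit b → a ≡ b
bit-injective = Injection.injective (↔⇒↣ (↔-sym 2↔Bool))

Added : ∀ {n} → Tree n → (Fin n → Fin n → Label n) → Term → Term → Set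
Added T add x y = ∃[ s ] ∃[ k₁ ] ∃[ k₂ ] (T s ≡ add k₁ k₂ × ColoredAt T s x k₁ × ColoredAt T s y k₂)

data Introducing {n} : Label n → Set where
  by-cst  : ∀ c k → Introducing (cst c k)
  by-star : ∀ k → Introducing (star k)

introducing-unary : ∀ {n} {l : Label n} → Introducing l → ¬ IsUnary l
introducing-unary (by-cst _ _) ()
introducing-unary (by-star _) ()

data Kind {n} (l : Label n) : Set where
  leaf-label  : IsLeaf l → Kind l
  unary-label : IsUnary l → Kind l
  oplus-label : l ≡ oplus → Kind l

kind : ∀ {n} (l : Label n) → Kind l
kind (cst _ _)     = leaf-label tt
kind (star _)      = leaf-label tt
kind void          = leaf-label tt
kind (addH _ _)    = unary-label tt
kind (addV _ _)    = unary-label tt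
kind (recolor _ _) = unary-label tt
kind oplus         = oplus-label refl

module _ {n} (T : Tree n) where

  introducing : ∀ {t x k} → Intro T t x k → Introducing (T t)
  introducing (inj₁ (c , e , _)) = subst Introducing (sym e) (by-cst c _)
  introducing (inj₂ (e , _))     = subst Introducing (sym e) (by-star _)

  intro-functional : ∀ {t x y k k′} → Intro T t x k → Intro T t y k′ → x ≡ y
  intro-functional (inj₁ (_ , e , refl)) (inj₁ (_ , e′ , refl)) with trans (sym e) e′
  ... | refl = refl
  intro-functional (inj₂ (_ , refl)) (inj₂ (_ , refl)) = refl
  intro-functional (inj₁ (_ , e , _)) (inj₂ (e′ , _)) with trans (sym e) e′
  ... | ()
  intro-functional (inj₂ (e , _)) (inj₁ (_ , e′ , _)) with trans (sym e) e′
  ... | ()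

  colorUp-++ : ∀ s w q k → colorUp T s (w ++ q) k ≡ colorUp T s w (colorUp T (s ++ w) q k)
  colorUp-++ s [] q k = cong (λ u → colorUp T u q k) (sym (++-identityʳ s))
  colorUp-++ s (b ∷ w) q k = cong (act (T s)) (trans (colorUp-++ (child s b) w q k)
    (cong (λ u → colorUp T (child s b) w (colorUp T u q k)) (++-assoc s [ b ] w)))

module WellDecoratedTree {n Cnst} (T : Tree n) (wd : WellDecorated Cnst T) where
  open WellDecorated wd using (cst-once) renaming (unary to unary-children; leaf to leaf-children)

  intro-unique : ∀ {t t′ x k k′} → Intro T t x k → Intro T t′ x k′ → t ≡ t′ × k ≡ k′
  intro-unique (inj₁ (c , e , refl)) (inj₁ (_ , e′ , refl)) with cst-once _ _ c _ _ e e′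
  ... | refl with trans (sym e) e′
  ... | refl = refl , refl
  intro-unique (inj₂ (e , refl)) (inj₂ (e′ , refl)) with trans (sym e) e′
  ... | refl = refl , refl
  intro-unique (inj₁ (_ , _ , refl)) (inj₂ (_ , ()))
  intro-unique (inj₂ (_ , refl)) (inj₁ (_ , _ , ()))

  leaf-child : ∀ {s} → IsLeaf (T s) → ∀ b → T (child s b) ≡ void
  leaf-child l false = proj₁ (leaf-children _ l)
  leaf-child l true  = proj₂ (leaf-children _ l)

  void-subtree : ∀ {v} → T v ≡ void → ∀ q → T (v ++ q) ≡ void
  void-subtree {v} e [] = subst (λ t → T t ≡ void) (sym (++-identityʳ v)) e
  void-subtree {v} e (b ∷ q) = subst (λ t → T t ≡ void) (++-assoc v [ b ] q)
    (void-subtree (leaf-child (subst IsLeaf (sym e) tt) b) q)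

  void-below : ∀ {v t x k} → T v ≡ void → v ⊑ t → ¬ Intro T t x k
  void-below e (q , refl) it with subst Introducing (void-subtree e q) (introducing T it)
  ... | ()

  leaf-below : ∀ {s t x k} → IsLeaf (T s) → s ⊑ t → Intro T t x k → t ≡ s
  leaf-below l s⊑t it with ⊑-children s⊑t
  ... | inj₁ t≡s = t≡s
  ... | inj₂ (b , below) = ⊥-elim (void-below (leaf-child l b) below it)

  unary-below : ∀ {s t x k} → IsUnary (T s) → s ⊑ t → Intro T t x k → child s false ⊑ t
  unary-below {s} u s⊑t it with ⊑-children s⊑t
  ... | inj₁ refl = ⊥-elim (introducing-unary (introducing T it) u)
  ... | inj₂ (false , below) = below
  ... | inj₂ (true , below) = ⊥-elim (void-below (proj₂ (unary-children s u)) below it)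

  oplus-below : ∀ {s t x k} → T s ≡ oplus → s ⊑ t → Intro T t x k → Σ Bool λ b → child s b ⊑ t
  oplus-below o s⊑t it with ⊑-children s⊑t
  ... | inj₂ below = below
  ... | inj₁ refl with subst Introducing o (introducing T it)
  ... | ()

  colored-below : ∀ {s t x k k′} → ColoredAt T s x k → Intro T t x k′ → s ⊑ t
  colored-below (p , _ , it , _) it′ = p , proj₁ (intro-unique it it′)

  adder-above : ∀ {r q x z s k₁ k₂ kx t kz} → Intro T (r ++ q) x kx → Intro T t z kz → ¬ r ⊑ t →
                ColoredAt T s x k₁ → ColoredAt T s z k₂ → s ⊑ r
  adder-above {q = q} ix iz r⋢t cx cz with ⊑-comparable (colored-below cx ix) (q , refl)
  ... | inj₁ s⊑r = s⊑r
  ... | inj₂ r⊑s = ⊥-elim (r⋢t (⊑-trans r⊑s (colored-below cz iz)))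

  color-transfer : ∀ {r qx qy x y kx ky s k} →
    Intro T (r ++ qx) x kx → Intro T (r ++ qy) y ky → colorUp T r qx kx ≡ colorUp T r qy ky →
    s ⊑ r → ColoredAt T s x k → ColoredAt T s y k
  color-transfer {qx = qx} {qy} {kx = kx} {ky} {s} {k} ix iy same (w , refl) (p , _ , ix′ , colored)
    with intro-unique ix′ ix
  ... | e , refl = w ++ qy , ky , subst (λ t → Intro T t _ ky) (++-assoc s w qy) iy , recolored
    where
      open ≡-Reasoning
      p≡ : w ++ qx ≡ p
      p≡ = ++-cancelˡ s (w ++ qx) p (trans (sym (++-assoc s w qx)) (sym e))

      recolored : colorUp T s (w ++ qy) ky ≡ k
      recolored = begin
        colorUp T s (w ++ qy) ky                   ≡⟨ colorUp-++ T s w qy ky ⟩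
        colorUp T s w (colorUp T (s ++ w) qy ky)   ≡⟨ cong (colorUp T s w) (sym same) ⟩
        colorUp T s w (colorUp T (s ++ w) qx kx)   ≡⟨ sym (colorUp-++ T s w qx kx) ⟩
        colorUp T s (w ++ qx) kx                   ≡⟨ cong (λ u → colorUp T s u kx) p≡ ⟩
        colorUp T s p kx                           ≡⟨ colored ⟩
        k                                          ∎

  Linked : (Fin n → Fin n → Label n) → Term → Term → Set
  Linked add x z = Added T add x z ⊎ Added T add z x

  linked-transfer : ∀ {add r qx qy x y z kx ky t kz} →
    Intro T (r ++ qx) x kx → Intro T (r ++ qy) y ky → colorUp T r qx kx ≡ colorUp T r qy ky →
    Intro T t z kz → ¬ r ⊑ t → Linked add x z → Linked add y z
  linked-transfer ix iy same iz r⋢t (inj₁ (s , k₁ , k₂ , e , cx , cz)) =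
    inj₁ (s , k₁ , k₂ , e , color-transfer ix iy same (adder-above ix iz r⋢t cx cz) cx , cz)
  linked-transfer ix iy same iz r⋢t (inj₂ (s , k₁ , k₂ , e , cz , cx)) =
    inj₂ (s , k₁ , k₂ , e , cz , color-transfer ix iy same (adder-above ix iz r⋢t cx cz) cx)

module Separation {n Cnst} (T : Tree n) (wd : WellDecorated Cnst T)
  (add : Fin n → Fin n → Label n) (E : ℕ → ℕ → Term) (E-dom : ∀ i j → Dom (Rep T) (E i j))
  (E-edge : ∀ i j → Added T add (E i j) (E i (suc j)))
  (line : Term → ℕ) (line-E : ∀ i j → line (E i j) ≡ i) (Added-line : ∀ {x y} → Added T add x y → line x ≡ line y)
  where
  open WellDecoratedTree T wd

  node : ℕ → ℕ → Node
  node i j = proj₁ (E-dom i j)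

  intro-color : ℕ → ℕ → Fin n
  intro-color i j = proj₁ (proj₂ (E-dom i j))

  introduced : ∀ i j → Intro T (node i j) (E i j) (intro-color i j)
  introduced i j = proj₂ (proj₂ (E-dom i j))

  size : ℕ
  size = 2 + 2 * n

  linked-line : ∀ {x z} → Linked add x z → line x ≡ line z
  linked-line (inj₁ a) = Added-line a
  linked-line (inj₂ a) = sym (Added-line a)

  record Crossing (r : Node) (i : ℕ) : Set where
    field
      inner outer : ℕ
      inner-below : r ⊑ node i inner
      outer-apart : ¬ r ⊑ node i outer
      linked      : Linked add (E i inner) (E i outer)

    color : Fin n
    color = colorUp T r (proj₁ inner-below) (intro-color i inner)

    inner-introduced : Intro T (r ++ proj₁ inner-below) (E i inner) (intro-color i inner)
    inner-introduced = subst (λ t → Intro T t _ _) (sym (proj₂ inner-below)) (introduced i inner)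
  open Crossing

  crossing : ∀ {r i j} → r ⊑ node i j → ¬ (∀ (j′ : Fin size) → r ⊑ node i (toℕ j′)) → Crossing r i
  crossing {r} {i} r⊑ij not-all with ¬∀⟶∃¬ size _ (λ j′ → r ⊑? node i (toℕ j′)) not-all
  ... | _ , r⋢ij′ with boundary (λ j → r ⊑? node i j) r⊑ij r⋢ij′
  ... | k , inj₁ (inside , outside) = record
    { inner = k ; outer = suc k ; inner-below = inside ; outer-apart = outside ; linked = inj₁ (E-edge i k) }
  ... | k , inj₂ (outside , inside) = record
    { inner = suc k ; outer = k ; inner-below = inside ; outer-apart = outside ; linked = inj₂ (E-edge i k) }

  crossing-line : ∀ {r i i′} (c : Crossing r i) (c′ : Crossing r i′) → color c ≡ color c′ → i′ ≡ i
  crossing-line {i = i} {i′} c c′ same = begin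
    i′                        ≡⟨ sym (line-E i′ (inner c′)) ⟩
    line (E i′ (inner c′))    ≡⟨ linked-line moved ⟩
    line (E i (outer c))      ≡⟨ sym (linked-line (linked c)) ⟩
    line (E i (inner c))      ≡⟨ line-E i (inner c) ⟩
    i                         ∎
    where
      open ≡-Reasoning
      moved : Linked add (E i′ (inner c′)) (E i (outer c))
      moved = linked-transfer (inner-introduced c) (inner-introduced c′) same
                (introduced i (outer c)) (outer-apart c) (linked c)

  module _ (s : Node) (j₀ : Fin size) (spans : ∀ (i : Fin size) → s ⊑ node (toℕ i) (toℕ j₀)) where

    leaf-split : IsLeaf (T s) → ⊥
    leaf-split l = 0≢1+n (begin
      0              ≡⟨ sym (line-E 0 j) ⟩
      line (E 0 j)   ≡⟨ cong line (intro-functional T (at-s fzero) (at-s (fsuc fzero))) ⟩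
      line (E 1 j)   ≡⟨ line-E 1 j ⟩
      1              ∎)
      where
        open ≡-Reasoning
        j : ℕ
        j = toℕ j₀
        at-s : ∀ i → Intro T s (E (toℕ i) j) (intro-color (toℕ i) j)
        at-s i = subst (λ t → Intro T t _ _) (leaf-below l (spans i) (introduced _ _)) (introduced _ _)

    module _ (o : T s ≡ oplus) (¬line : ∀ b (i : Fin size) → ¬ ∀ (j : Fin size) → child s b ⊑ node (toℕ i) (toℕ j)) where

      split-crossing : ∀ (i : Fin size) → Σ Bool λ b → Crossing (child s b) (toℕ i)
      split-crossing i = let b , below = oplus-below o (spans i) (introduced _ _) in b , crossing below (¬line b i)

      code : ∀ {i} → Σ Bool (λ b → Crossing (child s b) i) → Fin (2 * n)
      code (b , c) = combine (bit b) (color c)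

      code-line : ∀ {i i′} (c : Σ Bool λ b → Crossing (child s b) i) (c′ : Σ Bool λ b → Crossing (child s b) i′) →
                  code c ≡ code c′ → i′ ≡ i
      code-line (b , c) (b′ , c′) e with combine-injective (bit b) _ (bit b′) _ e
      ... | eb , same-color with bit-injective eb
      ... | refl = crossing-line c c′ same-color

      oplus-split : ⊥
      oplus-split with pigeonhole (s≤s (n≤1+n _)) (code ∘ split-crossing)
      ... | i , i′ , i<i′ , same-code =
        <⇒≢ i<i′ (toℕ-injective (sym (code-line (split-crossing i) (split-crossing i′) same-code)))

    no-split : (∀ b → ¬ ∀ (i : Fin size) → child s b ⊑ node (toℕ i) (toℕ j₀)) →
               (∀ b (i : Fin size) → ¬ ∀ (j : Fin size) → child s b ⊑ node (toℕ i) (toℕ j)) → ⊥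
    no-split ¬spans ¬line with kind (T s)
    ... | leaf-label l  = leaf-split l
    ... | unary-label u = ¬spans false λ i → unary-below u (spans i) (introduced _ _)
    ... | oplus-label o = oplus-split o ¬line

Rep-has-no-grid : ∀ {n Cnst} (T : Tree n) → WellDecorated Cnst T → (E : ℕ → ℕ → Term) →
  (∀ i j → Dom (Rep T) (E i j)) →
  (∀ i j → H (Rep T) (E i j) (E (suc i) j)) → (∀ i j → V (Rep T) (E i j) (E i (suc j))) →
  (π₁ π₂ : Term → ℕ) → (∀ i j → π₁ (E i j) ≡ i) → (∀ i j → π₂ (E i j) ≡ j) →
  (∀ {x y} → H (Rep T) x y → π₂ x ≡ π₂ y) → (∀ {x y} → V (Rep T) x y → π₁ x ≡ π₁ y) → ⊥
Rep-has-no-grid T wd E E-dom E-H E-V π₁ π₂ π₁-E π₂-E H-π₂ V-π₁ =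
  separate (deepest Spanned Spanned? B Spanned-short (inj₁ (fzero , λ _ → _ , refl)))
  where
    module Rows = Separation T wd addV E E-dom E-V π₁ π₁-E V-π₁
    module Columns = Separation T wd addH (λ i j → E j i) (λ i j → E-dom j i) (λ i j → E-H j i) π₂ (λ i j → π₂-E j i) H-π₂
    open Rows using (size; node)

    at : Fin size → Fin size → Node
    at i j = node (toℕ i) (toℕ j)

    Spanned : Node → Set
    Spanned s = (∃[ j ] ∀ i → s ⊑ at i j) ⊎ (∃[ i ] ∀ j → s ⊑ at i j)

    Spanned? : Decidable Spanned
    Spanned? s = any? (λ j → all? λ i → s ⊑? at i j) ⊎-dec any? (λ i → all? λ j → s ⊑? at i j)

    row-bound : Fin size → ℕ
    row-bound i = proj₁ (bounded λ j → length (at i j))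

    B : ℕ
    B = proj₁ (bounded row-bound)

    at-short : ∀ i j → length (at i j) ≤ B
    at-short i j = ≤-trans (proj₂ (bounded λ j → length (at i j)) j) (proj₂ (bounded row-bound) i)

    Spanned-short : ∀ {s} → Spanned s → length s ≤ B
    Spanned-short (inj₁ (j , spans)) = ≤-trans (⊑-length (spans fzero)) (at-short fzero j)
    Spanned-short (inj₂ (i , spans)) = ≤-trans (⊑-length (spans fzero)) (at-short i fzero)

    separate : ∃[ s ] (Spanned s × ∀ b → ¬ Spanned (child s b)) → ⊥
    separate (s , inj₁ (j , spans) , ¬spanned) =
      Rows.no-split s j spans (λ b → ¬spanned b ∘ inj₁ ∘ (j ,_)) (λ b i → ¬spanned b ∘ inj₂ ∘ (i ,_))
    separate (s , inj₂ (i , spans) , ¬spanned) =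
      Columns.no-split s i spans (λ b → ¬spanned b ∘ inj₂ ∘ (i ,_)) (λ b j → ¬spanned b ∘ inj₁ ∘ (j ,_))

Pos : Set
Pos = Maybe (ℕ × ℕ)

right up : Pos → Pos
right nothing        = nothing
right (just (i , j)) = just (suc i , j)
up nothing           = nothing
up (just (i , j))    = just (i , suc j)

up-right : ∀ p → up (right p) ≡ right (up p)
up-right nothing  = refl
up-right (just _) = refl

coord₁ coord₂ : Pos → ℕ
coord₁ nothing        = 0
coord₁ (just (i , _)) = i
coord₂ nothing        = 0
coord₂ (just (_ , j)) = j

up-coord₁ : ∀ {p q} → up p ≡ q → coord₁ p ≡ coord₁ q
up-coord₁ {nothing} refl = refl
up-coord₁ {just _}  refl = refl

right-coord₂ : ∀ {p q} → right p ≡ q → coord₂ p ≡ coord₂ q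
right-coord₂ {nothing} refl = refl
right-coord₂ {just _}  refl = refl

grid-positions : ∀ {A : Set} (π : A → Pos) (E : ℕ → ℕ → A) → π (E 0 0) ≡ just (0 , 0) →
  (∀ i j → right (π (E i j)) ≡ π (E (suc i) j)) → (∀ i j → up (π (E i j)) ≡ π (E i (suc j))) →
  ∀ i j → π (E i j) ≡ just (i , j)
grid-positions π E origin E-right E-up zero zero = origin
grid-positions π E origin E-right E-up zero (suc j) =
  trans (sym (E-up 0 j)) (cong up (grid-positions π E origin E-right E-up 0 j))
grid-positions π E origin E-right E-up (suc i) j =
  trans (sym (E-right i j)) (cong right (grid-positions π E origin E-right E-up i j))

decode : Node → Pos
decode []          = just (0 , 0)
decode (true ∷ l)  = right (decode l)
decode (false ∷ l) = up (decode l)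

encode : ℕ → ℕ → Node
encode zero zero    = []
encode zero (suc j) = false ∷ encode zero j
encode (suc i) j    = true ∷ encode i j

decode-encode : ∀ i j → decode (encode i j) ≡ just (i , j)
decode-encode zero zero    = refl
decode-encode zero (suc j) = cong up (decode-encode zero j)
decode-encode (suc i) j    = cong right (decode-encode i j)

-- The null at the root is the loop point; every constant sits at the origin.
pos : Term → Pos
pos (const _)      = just (0 , 0)
pos (null [])      = nothing
pos (null (_ ∷ l)) = decode l

place : Pos → Term
place nothing        = null []
place (just (i , j)) = null (false ∷ encode i j)

pos-place : ∀ p → pos (place p) ≡ p
pos-place nothing        = refl
pos-place (just (i , j)) = decode-encode i j

positions : Instance
positions = record
  { Dom   = λ _ → ⊤
  ; H     = λ x y → right (pos x) ≡ pos y
  ; V     = λ x y → up (pos x) ≡ pos y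
  ; H-dom = λ _ → tt , tt
  ; V-dom = λ _ → tt , tt
  }

positions-model : ModelGrid [ topA 0 ] positions
positions-model = contains , (null [] , refl , refl) , grow , grid
  where
    contains : Contains positions [ topA 0 ]
    contains _ (here refl) = tt
    contains _ (there ())

    grow : SatGrow positions
    grow x _ = place (right (pos x)) , place (up (pos x)) , sym (pos-place _) , sym (pos-place _)

    grid : SatGrid positions
    grid x y x′ xHy xVx′ = place (right (pos x′)) , sym (pos-place _) , (begin
      up (pos y)           ≡⟨ cong up (sym xHy) ⟩
      up (right (pos x))   ≡⟨ up-right (pos x) ⟩
      right (up (pos x))   ≡⟨ cong right xVx′ ⟩
      right (pos x′)       ≡⟨ sym (pos-place _) ⟩
      pos (place (right (pos x′))) ∎)
      where open ≡-Reasoning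

module GridIn (U : Instance) (grow : SatGrow U) (grid : SatGrid U) (a : Term) (a-dom : Dom U a) where

  record Column : Set where
    field
      cell     : ℕ → Term
      cell-dom : Dom U (cell 0)
      cell-V   : ∀ j → V U (cell j) (cell (suc j))
  open Column

  above : Σ Term (Dom U) → Σ Term (Dom U)
  above (x , x-dom) = let _ , y′ , _ , xVy′ = grow x x-dom in y′ , proj₂ (V-dom U xVy′)

  climb : ℕ → Σ Term (Dom U)
  climb zero    = a , a-dom
  climb (suc j) = above (climb j)

  first-column : Column
  first-column = record
    { cell = proj₁ ∘ climb ; cell-dom = a-dom ; cell-V = λ j → proj₂ (proj₂ (proj₂ (grow _ (proj₂ (climb j))))) }

  square : (c : Column) → ∀ j → (r : Σ Term (H U (cell c j))) →
           ∃[ y′ ] (H U (cell c (suc j)) y′ × V U (proj₁ r) y′)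
  square c j (y , xHy) = grid (cell c j) y (cell c (suc j)) xHy (cell-V c j)

  rightward : (c : Column) → ∀ j → Σ Term (H U (cell c j))
  rightward c zero    = let y , _ , xHy , _ = grow (cell c 0) (cell-dom c) in y , xHy
  rightward c (suc j) = let y′ , H′ , _ = square c j (rightward c j) in y′ , H′

  next-column : Column → Column
  next-column c = record
    { cell     = proj₁ ∘ rightward c
    ; cell-dom = proj₂ (H-dom U (proj₂ (rightward c 0)))
    ; cell-V   = λ j → proj₂ (proj₂ (square c j (rightward c j)))
    }

  column : ℕ → Column
  column zero    = first-column
  column (suc i) = next-column (column i)

  grid-cell : ℕ → ℕ → Term
  grid-cell i = cell (column i)

  grid-cell-H : ∀ i j → H U (grid-cell i j) (grid-cell (suc i) j)
  grid-cell-H i = proj₂ ∘ rightward (column i)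

  grid-cell-V : ∀ i j → V U (grid-cell i j) (grid-cell i (suc j))
  grid-cell-V i = cell-V (column i)

  grid-cell-dom : ∀ i j → Dom U (grid-cell i j)
  grid-cell-dom i j = proj₁ (V-dom U (grid-cell-V i j))

lemma33 : ¬ FcsGrid
lemma33 fcs with fcs [ topA 0 ]
... | U , ((contains , _ , grow , grid) , universal) , _ , _ , T , wd , f , g , _ =
  Rep-has-no-grid T wd E (λ i j → dom-pres f (grid-cell-dom i j))
    (λ i j → H-pres f (grid-cell-H i j)) (λ i j → V-pres f (grid-cell-V i j))
    (coord₁ ∘ π) (coord₂ ∘ π) (λ i j → cong coord₁ (π-E i j)) (λ i j → cong coord₂ (π-E i j))
    (right-coord₂ ∘ π-H) (up-coord₁ ∘ π-V)
  where
    open GridIn U grow grid (const 0) (contains _ (here refl))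
    h : Hom U positions
    h = universal positions positions-model

    E : ℕ → ℕ → Term
    E i j = map f (grid-cell i j)

    π : Term → Pos
    π x = pos (map h (map g x))

    π-H : ∀ {x y} → H (Rep T) x y → right (π x) ≡ π y
    π-H = H-pres h ∘ H-pres g

    π-V : ∀ {x y} → V (Rep T) x y → up (π x) ≡ π y
    π-V = V-pres h ∘ V-pres g

    origin : π (E 0 0) ≡ just (0 , 0)
    origin rewrite const-id f 0 | const-id g 0 | const-id h 0 = refl

    π-E : ∀ i j → π (E i j) ≡ just (i , j)
    π-E = grid-positions π E origin (λ i j → π-H (H-pres f (grid-cell-H i j))) (λ i j → π-V (V-pres f (grid-cell-V i j)))
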